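{- Let $H$ be a $2$-vertex-connected undirected graph and $T$ a DFS tree of $H$ rooted at $r$. Let $v$ be a vertex and $e$ a back-edge. If $H\setminus\{v,e\}$ is not connected, then $e$ starts from the subtree $T(c)$ of some child $c$ of $v$, ends in a proper ancestor of $v$, and is the only back-edge that starts from $T(c)$ and ends in a proper ancestor of $v$. Conversely, if $e$ is a back-edge with these properties (for some child $c$ of $v$), then $H\setminus\{v,e\}$ is not connected.
   Context: Vertices are ancestors/descendants of themselves. Edges of $H$ not in $T$ are back-edges; a back-edge $(x,y)$ joins a descendant $x$ ("start") to an ancestor $y$ ("end"). $T(c)$ is the subtree rooted at $c$. $H\setminus\{v,e\}$ is obtained by deleting $v$ with its incident edges and the edge $e$. -}

module Defs where

open import Data.Nat using (ℕ; _≤_)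
open import Data.Fin using (Fin)
open import Data.Product using (Σ; ∃; ∃-syntax; _×_; _,_)
open import Data.Sum using (_⊎_)
open import Relation.Nullary using (¬_)
open import Relation.Binary.PropositionalEquality using (_≡_; _≢_)

record Graph (n : ℕ) : Set₁ where
  field
    Adj   : Fin n → Fin n → Set
    sym   : ∀ {x y} → Adj x y → Adj y x
    irrefl : ∀ {x} → ¬ Adj x x
open Graph public

data Walk {n : ℕ} (P : Fin n → Set) (E : Fin n → Fin n → Set) : Fin n → Fin n → Set where
  here : ∀ {a} → Walk P E a a
  step : ∀ {a b c} → E a b → P b → Walk P E b c → Walk P E a c

Connected : {n : ℕ} → (Fin n → Set) → (Fin n → Fin n → Set) → Set
Connected P E = ∀ a b → P a → P b → Walk P E a b

GraphConnected : {n : ℕ} → Graph n → Set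
GraphConnected {n} G = Connected (λ _ → Fin n) (Adj G)

DelVertexConnected : {n : ℕ} → Graph n → Fin n → Set
DelVertexConnected G v = Connected (λ a → a ≢ v) (Adj G)

TwoVertexConnected : {n : ℕ} → Graph n → Set
TwoVertexConnected {n} G =
  (3 ≤ n) × GraphConnected G × (∀ v → DelVertexConnected G v)

SameEdge : {n : ℕ} → Fin n → Fin n → Fin n → Fin n → Set
SameEdge a b x y = (a ≡ x × b ≡ y) ⊎ (a ≡ y × b ≡ x)

DelVertexEdge-Connected : {n : ℕ} → Graph n → Fin n → Fin n → Fin n → Set
DelVertexEdge-Connected G v x y =
  Connected (λ a → a ≢ v) (λ a b → Adj G a b × ¬ SameEdge a b x y)

-- AncP r p x y : x is an ancestor of y (reflexive) w.r.t. root r and parent function p.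
data AncP {n : ℕ} (r : Fin n) (p : Fin n → Fin n) : Fin n → Fin n → Set where
  self : ∀ {x} → AncP r p x x
  up   : ∀ {x y} → y ≢ r → AncP r p x (p y) → AncP r p x y

record RootedSpanningTree {n : ℕ} (G : Graph n) (r : Fin n) : Set₁ where
  field
    parent     : Fin n → Fin n
    parent-adj : ∀ v → v ≢ r → Adj G v (parent v)
    root-anc   : ∀ v → AncP r parent r v   -- every vertex climbs to r: T is a spanning tree

  Anc : Fin n → Fin n → Set
  Anc = AncP r parent

  ProperAnc : Fin n → Fin n → Set
  ProperAnc x y = Anc x y × x ≢ y

  Child : Fin n → Fin n → Set
  Child c v = c ≢ r × parent c ≡ v

  TreeEdge : Fin n → Fin n → Set
  TreeEdge a b = (a ≢ r × parent a ≡ b) ⊎ (b ≢ r × parent b ≡ a)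

  -- back-edge (x , y): a non-tree edge of G with start x and end y, y an ancestor of x
  BackEdge : Fin n → Fin n → Set
  BackEdge x y = Adj G x y × ¬ TreeEdge x y × Anc y x

open RootedSpanningTree public

-- A DFS tree: a rooted spanning tree all of whose non-tree edges join
-- an ancestor and a descendant (these are exactly the trees produced by DFS).
record DFSTree {n : ℕ} (G : Graph n) (r : Fin n) : Set₁ where
  field
    tree   : RootedSpanningTree G r
    normal : ∀ x y → Adj G x y → Anc tree x y ⊎ Anc tree y x
open DFSTree public

module Submission where

-- Deleting e from H ∖ v destroys connectivity exactly when x and y can no
-- longer be joined in H ∖ {v , e} (every other use of e can be rerouted).
--
-- (⇒) If x and y are not joined, v is none of them and lies on the tree path
--     from x up to y (otherwise that path is a detour); so x ∈ T(c) for a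
--     child c of v and y is a proper ancestor of v.  A second back-edge
--     (x′ , y′) from T(c) to a proper ancestor of v would give the detour
--     x → c → x′ → y′ → y, through T(c) and along the branch above v.
-- (⇐) By the normality of DFS trees, the only edges leaving T(c) go to v,
--     via tree edges, or to proper ancestors of v, via back-edges; hence the
--     subtree T(c) is closed in H ∖ {v , e}, and y lies outside it.

open import Defs
open import Data.Nat using (ℕ; zero; suc; _≤_; _<_)
open import Data.Nat.Properties using (≤-refl; ≤-reflexive; m≤n⇒m≤1+n; <⇒≱; ≤-<-trans)
open import Data.Fin using (Fin; _≟_)
open import Data.Product using (∃-syntax; _×_; _,_; proj₁; proj₂)
open import Data.Sum using (_⊎_; inj₁; inj₂)
open import Data.Empty using (⊥; ⊥-elim)
open import Function.Bundles using (_⇔_; mk⇔)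
open import Relation.Nullary using (¬_; Dec; yes; no)
open import Relation.Nullary.Decidable using (_×-dec_; _⊎-dec_; decidable-stable)
open import Relation.Binary.PropositionalEquality
  using (_≡_; _≢_; refl; trans; cong; subst) renaming (sym to ≡-sym)

module _ {n : ℕ} {P : Fin n → Set} {E : Fin n → Fin n → Set} where

  _++_ : ∀ {a b c} → Walk P E a b → Walk P E b c → Walk P E a c
  here ++ w′ = w′
  step e pb w ++ w′ = step e pb (w ++ w′)

  reverse : (∀ {a b} → E a b → E b a) → ∀ {a b} → P a → Walk P E a b → Walk P E b a
  reverse E-sym pa here = here
  reverse E-sym pa (step e pb w) = reverse E-sym pb w ++ step (E-sym e) pa here

-- Deleting a single edge {x , y} from a connected subgraph: the result stays
-- connected as soon as x and y are still joined, since every traversal of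
-- {x , y} can be replaced by that walk.
module EdgeDeletion {n : ℕ} (G : Graph n) (x y : Fin n) where

  WithoutEdge : Fin n → Fin n → Set
  WithoutEdge a b = Adj G a b × ¬ SameEdge a b x y

  without-sym : ∀ {a b} → WithoutEdge a b → WithoutEdge b a
  without-sym (ab , not-xy) = Graph.sym G ab , λ
    { (inj₁ (b≡x , a≡y)) → not-xy (inj₂ (a≡y , b≡x))
    ; (inj₂ (b≡y , a≡x)) → not-xy (inj₁ (a≡x , b≡y)) }

  same-edge? : ∀ a b → Dec (SameEdge a b x y)
  same-edge? a b = ((a ≟ x) ×-dec (b ≟ y)) ⊎-dec ((a ≟ y) ×-dec (b ≟ x))

  bypass : ∀ {P : Fin n → Set} → (P x → P y → Walk P WithoutEdge x y) →
           ∀ {a b} → P a → Walk P (Adj G) a b → Walk P WithoutEdge a b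
  bypass joined pa here = here
  bypass joined {a} pa (step {b = b} ab pb w) with same-edge? a b
  ... | yes (inj₁ (refl , refl)) = joined pa pb ++ bypass joined pb w
  ... | yes (inj₂ (refl , refl)) = reverse without-sym pb (joined pb pa) ++ bypass joined pb w
  ... | no not-xy = step (ab , not-xy) pb (bypass joined pb w)

  connected-without-edge : ∀ {P : Fin n → Set} → Connected P (Adj G) →
                           (P x → P y → Walk P WithoutEdge x y) → Connected P WithoutEdge
  connected-without-edge conn joined a b pa pb = bypass joined pa (conn a b pa pb)

module TreeFacts {n : ℕ} {G : Graph n} {r : Fin n} (T : RootedSpanningTree G r) where

  steps : ∀ {a b} → Anc T a b → ℕ
  steps self = zero
  steps (up _ q) = suc (steps q)

  -- All paths from the root have the same length: only the root has no parent step.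
  root-steps-unique : ∀ {z} (q q′ : Anc T r z) → steps q ≡ steps q′
  root-steps-unique self self = refl
  root-steps-unique self (up r≢r _) = ⊥-elim (r≢r refl)
  root-steps-unique (up r≢r _) self = ⊥-elim (r≢r refl)
  root-steps-unique (up _ q) (up _ q′) = cong suc (root-steps-unique q q′)

  depth : Fin n → ℕ
  depth z = steps (root-anc T z)

  depth-parent : ∀ {z} → z ≢ r → depth z ≡ suc (depth (parent T z))
  depth-parent {z} z≢r = root-steps-unique (root-anc T z) (up z≢r (root-anc T (parent T z)))

  parent-shallower : ∀ {z} → z ≢ r → depth (parent T z) < depth z
  parent-shallower z≢r = ≤-reflexive (≡-sym (depth-parent z≢r))

  anc-depth : ∀ {a b} → Anc T a b → depth a ≤ depth b
  anc-depth self = ≤-refl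
  anc-depth (up b≢r a≤pb) =
    subst (_ ≤_) (≡-sym (depth-parent b≢r)) (m≤n⇒m≤1+n (anc-depth a≤pb))

  anc-antisym : ∀ {a b} → Anc T a b → Anc T b a → a ≡ b
  anc-antisym self _ = refl
  anc-antisym (up b≢r a≤pb) b≤a =
    ⊥-elim (<⇒≱ (≤-<-trans (anc-depth a≤pb) (parent-shallower b≢r)) (anc-depth b≤a))

  anc-trans : ∀ {a b c} → Anc T a b → Anc T b c → Anc T a c
  anc-trans a≤b self = a≤b
  anc-trans a≤b (up c≢r b≤pc) = up c≢r (anc-trans a≤b b≤pc)

  anc-comparable : ∀ {a b z} → Anc T a z → Anc T b z → Anc T a b ⊎ Anc T b a
  anc-comparable self b≤z = inj₂ b≤z
  anc-comparable (up z≢r a≤pz) self = inj₁ (up z≢r a≤pz)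
  anc-comparable (up _ a≤pz) (up _ b≤pz) = anc-comparable a≤pz b≤pz

  anc-parent : ∀ {a z} → Anc T a z → a ≢ z → Anc T a (parent T z)
  anc-parent self a≢a = ⊥-elim (a≢a refl)
  anc-parent (up _ a≤pz) _ = a≤pz

  anc? : ∀ a b → Dec (Anc T a b)
  anc? a b = climb b (root-anc T b)
    where
    climb : ∀ z → Anc T r z → Dec (Anc T a z)
    climb z r≤z with a ≟ z
    ... | yes refl = yes self
    climb z self | no a≢r = no λ { self → a≢r refl ; (up r≢r _) → r≢r refl }
    climb z (up z≢r r≤pz) | no a≢z with climb (parent T z) r≤pz
    ... | yes a≤pz = yes (up z≢r a≤pz)
    ... | no a≰pz = no λ { self → a≢z refl ; (up _ a≤pz) → a≰pz a≤pz }

  child-towards : ∀ {u z} → Anc T u z → u ≢ z → ∃[ c ] (Child T c u × Anc T c z)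
  child-towards self u≢u = ⊥-elim (u≢u refl)
  child-towards {u} (up {y = z} z≢r u≤pz) _ with u ≟ parent T z
  ... | yes u≡pz = z , (z≢r , ≡-sym u≡pz) , self
  ... | no u≢pz with child-towards u≤pz u≢pz
  ... | c , c-child , c≤pz = c , c-child , up z≢r c≤pz

  child-not-ancestor : ∀ {c v} → Child T c v → ¬ Anc T c v
  child-not-ancestor (c≢r , pc≡v) c≤v =
    <⇒≱ (parent-shallower c≢r) (subst (λ u → _ ≤ depth u) (≡-sym pc≡v) (anc-depth c≤v))

  above-proper-ancestor : ∀ {w a v} → Anc T w a → Anc T a v → a ≢ v → w ≢ v
  above-proper-ancestor v≤a a≤v a≢v refl = a≢v (anc-antisym a≤v v≤a)

  outside-subtree-above : ∀ {c v a b} → Child T c v → Anc T c a → Anc T b a →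
                          ¬ Anc T c b → Anc T b v
  outside-subtree-above (_ , pc≡v) c≤a b≤a c≰b with anc-comparable c≤a b≤a
  ... | inj₁ c≤b = ⊥-elim (c≰b c≤b)
  ... | inj₂ b≤c = subst (Anc T _) pc≡v (anc-parent b≤c λ { refl → c≰b self })

  tree-edge-leaving-subtree : ∀ {c v a b} → Child T c v → Anc T c a → TreeEdge T a b →
                              ¬ Anc T c b → b ≡ v
  tree-edge-leaving-subtree (_ , pc≡v) self (inj₁ (_ , pc≡b)) _ = trans (≡-sym pc≡b) pc≡v
  tree-edge-leaving-subtree _ (up _ c≤pa) (inj₁ (_ , pa≡b)) c≰b =
    ⊥-elim (c≰b (subst (Anc T _) pa≡b c≤pa))
  tree-edge-leaving-subtree _ c≤a (inj₂ (b≢r , pb≡a)) c≰b =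
    ⊥-elim (c≰b (anc-trans c≤a (up b≢r (subst (Anc T _) (≡-sym pb≡a) self))))

module TreeWalks {n : ℕ} {G : Graph n} {r : Fin n} (T : RootedSpanningTree G r)
                 {P : Fin n → Set} {E : Fin n → Fin n → Set}
                 (E-sym : ∀ {a b} → E a b → E b a)
                 (parent-edge : ∀ a → a ≢ r → E a (parent T a)) where

  climb : ∀ {a b} → Anc T a b → (∀ w → Anc T a w → Anc T w b → P w) → Walk P E b a
  climb self _ = here
  climb (up b≢r a≤pb) between =
    step (parent-edge _ b≢r) (between _ a≤pb (up b≢r self))
         (climb a≤pb λ w a≤w w≤pb → between w a≤w (up b≢r w≤pb))

  within-subtree : ∀ {c a b} → (∀ w → Anc T c w → P w) →
                   Anc T c a → Anc T c b → Walk P E a b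
  within-subtree in-P c≤a c≤b =
    climb c≤a (λ w c≤w _ → in-P w c≤w)
    ++ reverse E-sym (in-P _ c≤b) (climb c≤b (λ w c≤w _ → in-P w c≤w))

  along-branch : ∀ {a b} → (∀ w → Anc T w a → P w) → (∀ w → Anc T w b → P w) →
                 Anc T a b ⊎ Anc T b a → Walk P E a b
  along-branch _ in-P-b (inj₁ a≤b) =
    reverse E-sym (in-P-b _ self) (climb a≤b (λ w _ w≤b → in-P-b w w≤b))
  along-branch in-P-a _ (inj₂ b≤a) = climb b≤a (λ w _ w≤a → in-P-a w w≤a)

module VertexBackEdgeCut {n : ℕ} (H : Graph n) {r : Fin n} (D : DFSTree H r)
                         (v x y : Fin n) (xy : BackEdge (tree D) x y) where

  T : RootedSpanningTree H r
  T = tree D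

  open TreeFacts T
  open EdgeDeletion H x y

  AvoidsV : Fin n → Set
  AvoidsV a = a ≢ v

  SoleEscape : Fin n → Set
  SoleEscape c = ∀ x′ y′ → BackEdge T x′ y′ → Anc T c x′ → ProperAnc T y′ v → x′ ≡ x × y′ ≡ y

  Separating : Set
  Separating = ∃[ c ] (Child T c v × Anc T c x × ProperAnc T y v × SoleEscape c)

  -- Tree edges survive the deletion, because xy is not a tree edge.
  parent-edge-kept : ∀ a → a ≢ r → WithoutEdge a (parent T a)
  parent-edge-kept a a≢r = parent-adj T a a≢r , λ
    { (inj₁ (refl , pa≡y)) → not-tree (inj₁ (a≢r , pa≡y))
    ; (inj₂ (refl , pa≡x)) → not-tree (inj₂ (a≢r , pa≡x)) }
    where
    not-tree : ¬ TreeEdge T x y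
    not-tree = proj₁ (proj₂ xy)

  open TreeWalks T {AvoidsV} {WithoutEdge} without-sym parent-edge-kept

  subtree-avoids : ∀ {c w} → Child T c v → Anc T c w → w ≢ v
  subtree-avoids c-child c≤w refl = child-not-ancestor c-child c≤w

  -- (⇒) Each failure of the separation condition produces a walk from x to y,
  -- which reconnects H ∖ {v , e} since H ∖ v is connected.
  forward : DelVertexConnected H v → ¬ DelVertexEdge-Connected H v x y → Separating
  forward H∖v-connected disconnected = c , c-child , c≤x , (y≤v , y≢v) , sole-escape
    where
    x≢v : x ≢ v
    x≢v refl = disconnected (connected-without-edge H∖v-connected λ x≢x _ → ⊥-elim (x≢x refl))

    y≢v : y ≢ v
    y≢v refl = disconnected (connected-without-edge H∖v-connected λ _ y≢y → ⊥-elim (y≢y refl))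

    not-joined : ¬ Walk AvoidsV WithoutEdge x y
    not-joined x⇝y = disconnected (connected-without-edge H∖v-connected λ _ _ → x⇝y)

    -- Otherwise the tree path from x up to y avoids v.
    v-on-tree-path : Anc T y v × Anc T v x
    v-on-tree-path = decidable-stable (anc? y v ×-dec anc? v x) λ v-off-path →
      not-joined (climb (proj₂ (proj₂ xy)) λ { w y≤w w≤x refl → v-off-path (y≤w , w≤x) })

    y≤v : Anc T y v
    y≤v = proj₁ v-on-tree-path

    child-on-path : ∃[ c ] (Child T c v × Anc T c x)
    child-on-path = child-towards (proj₂ v-on-tree-path) λ { refl → x≢v refl }

    c : Fin n
    c = proj₁ child-on-path

    c-child : Child T c v
    c-child = proj₁ (proj₂ child-on-path)

    c≤x : Anc T c x
    c≤x = proj₂ (proj₂ child-on-path)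

    y-outside : ¬ Anc T c y
    y-outside c≤y = child-not-ancestor c-child (anc-trans c≤y y≤v)

    -- A different escaping back-edge (x′ , y′) yields the detour x → c → x′ → y′ → y.
    sole-escape : SoleEscape c
    sole-escape x′ y′ (x′y′ , _ , _) c≤x′ (y′≤v , y′≢v) =
      decidable-stable ((x′ ≟ x) ×-dec (y′ ≟ y)) λ other-edge →
        not-joined (within-subtree (λ _ → subtree-avoids c-child) c≤x c≤x′
                    ++ step (x′y′ , kept other-edge) y′≢v
                            (along-branch (λ _ w≤y′ → above-proper-ancestor w≤y′ y′≤v y′≢v)
                                          (λ _ w≤y → above-proper-ancestor w≤y y≤v y≢v)
                                          (anc-comparable y′≤v y≤v)))
      where
      kept : ¬ (x′ ≡ x × y′ ≡ y) → ¬ SameEdge x′ y′ x y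
      kept other-edge (inj₁ same) = other-edge same
      kept _ (inj₂ (refl , _)) = y-outside c≤x′

  -- Under SoleEscape, no edge of H ∖ {v , e} leaves T(c): an edge up to a proper
  -- ancestor of v would be a second escaping back-edge, a tree edge can only lead to v.
  edge-stays : ∀ {c a b} → Child T c v → SoleEscape c → Anc T c a →
               Adj H a b → ¬ SameEdge a b x y → b ≢ v → Anc T c b
  edge-stays {c} {a} {b} c-child sole c≤a ab not-xy b≢v =
    decidable-stable (anc? c b) λ c≰b → by-normality c≰b (normal D a b ab)
    where
    by-normality : ¬ Anc T c b → Anc T a b ⊎ Anc T b a → ⊥
    by-normality c≰b (inj₁ a≤b) = c≰b (anc-trans c≤a a≤b)
    by-normality c≰b (inj₂ b≤a) =
      not-xy (inj₁ (sole a b (ab , not-tree , b≤a) c≤a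
                         (outside-subtree-above c-child c≤a b≤a c≰b , b≢v)))
      where
      not-tree : ¬ TreeEdge T a b
      not-tree ab-tree = b≢v (tree-edge-leaving-subtree c-child c≤a ab-tree c≰b)

  subtree-closed : ∀ {c a b} → Child T c v → SoleEscape c → Anc T c a →
                   Walk AvoidsV WithoutEdge a b → Anc T c b
  subtree-closed c-child sole c≤a here = c≤a
  subtree-closed c-child sole c≤a (step (ab , not-xy) b≢v w) =
    subtree-closed c-child sole (edge-stays c-child sole c≤a ab not-xy b≢v) w

  -- (⇐) A walk from x ∈ T(c) to y would keep y in T(c), putting c above v.
  backward : Separating → ¬ DelVertexEdge-Connected H v x y
  backward (c , c-child , c≤x , (y≤v , y≢v) , sole) connected =
    child-not-ancestor c-child
      (anc-trans (subtree-closed c-child sole c≤x (connected x y (subtree-avoids c-child c≤x) y≢v))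
                 y≤v)

proposition1 : ∀ {n : ℕ} (H : Graph n) (r : Fin n) (D : DFSTree H r) →
    TwoVertexConnected H →
    (v x y : Fin n) → BackEdge (tree D) x y →
    (¬ DelVertexEdge-Connected H v x y)
      ⇔ (∃[ c ] (Child (tree D) c v × Anc (tree D) c x × ProperAnc (tree D) y v
           × (∀ x′ y′ → BackEdge (tree D) x′ y′ → Anc (tree D) c x′
                → ProperAnc (tree D) y′ v → x′ ≡ x × y′ ≡ y)))
proposition1 H r D (_ , _ , no-cut-vertex) v x y xy =
  mk⇔ (forward (no-cut-vertex v)) backward
  where open VertexBackEdgeCut H D v x y xy
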